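{- Let $G$ be a circulant graph on $m$ vertices (possibly with loops) and let $n\ge 1$. Then $K_n^*\otimes G$ is a circulant graph.
   Context: Graphs have no multiple edges but may have loops. $K_n^*$ denotes the complete graph on $n$ vertices with a loop at every vertex (its adjacency matrix is the all-ones matrix). The tensor product $G\otimes H$ has vertex set $V(G)\times V(H)$, with $(g,h)$ adjacent to $(g',h')$ iff $g$ is adjacent to $g'$ in $G$ and $h$ is adjacent to $h'$ in $H$ (here a vertex with a loop is adjacent to itself). A graph on $N$ vertices is circulant if its vertices can be labeled by $\mathbb{Z}_N$ so that, for some set $S\subseteq\mathbb{Z}_N$ with $S=-S$, vertices $i$ and $j$ (possibly equal) are adjacent iff $j-i\in S\pmod N$; loops occur exactly when $0\in S$. -}

module Defs where

open import Level using (0ℓ)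
open import Data.Nat using (ℕ; zero; suc; _+_; _*_; _∸_; _<_; _≤ᵇ_)
open import Data.Bool using (if_then_else_)
open import Data.Fin using (Fin; toℕ)
open import Data.Product using (_×_; Σ-syntax; ∃-syntax)
open import Data.Unit using (⊤)
open import Function.Bundles using (_⤖_; _⇔_; Bijection)

-- A graph (no multiple edges, loops allowed): a vertex type together with a
-- symmetric adjacency relation; Adj v v means there is a loop at v.
record Graph : Set₁ where
  field
    V   : Set
    Adj : V → V → Set
    sym : ∀ {u v} → Adj u v → Adj v u
open Graph public

-- residue of (j - i) mod N, for i j < N, computed in ℕ
diffMod : (N i j : ℕ) → ℕ
diffMod N i j = if i ≤ᵇ j then j ∸ i else (N + j) ∸ i

-- residue of (- k) mod N, for k < N
negMod : (N k : ℕ) → ℕ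
negMod N zero    = zero
negMod N (suc k) = N ∸ suc k

-- S is a predicate on residues 0..N-1.
Circulant : ℕ → Graph → Set₁
Circulant N G =
  Σ[ σ ∈ (Fin N ⤖ V G) ] Σ[ S ∈ (ℕ → Set) ]
    ((∀ k → k < N → (S k ⇔ S (negMod N k))) ×
     (∀ (i j : Fin N) →
        (Adj G (Bijection.to σ i) (Bijection.to σ j) ⇔ S (diffMod N (toℕ i) (toℕ j)))))

Kstar : ℕ → Graph
Kstar n = record { V = Fin n ; Adj = λ _ _ → ⊤ ; sym = λ x → x }

_⊗_ : Graph → Graph → Graph
G ⊗ H = record
  { V   = V G × V H
  ; Adj = λ p q → Adj G (proj₁' p) (proj₁' q) × Adj H (proj₂' p) (proj₂' q)
  ; sym = λ { (a , b) → Graph.sym G a , Graph.sym H b }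
  }
  where
  open import Data.Product using (_,_) renaming (proj₁ to proj₁'; proj₂ to proj₂')

-- Label the vertex (a , σ r) of Kₙ* ⊗ G by a·m + r ∈ ℤ_{nm}.  Every pair of vertices of Kₙ*
-- is adjacent, so labels x, y are adjacent iff their remainders mod m are adjacent in G,
-- i.e. iff (y − x) mod m ∈ S, because reduction mod m commutes with differences mod nm
-- (as m ∣ nm).  Hence S′ = {d : d mod m ∈ S} is a connection set, and S′ = −S′ since S = −S.
module Submission where

open import Defs hiding (sym)
open import Data.Nat.Base using (ℕ; zero; suc; _+_; _*_; _∸_; _<_; _≤_; _≥_; _≤ᵇ_; NonZero)
open import Data.Nat.Properties
open import Data.Nat.DivMod
open import Data.Nat.Divisibility using (_∣_; ∣-refl; m∣m*n; n∣m*n)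
open import Data.Bool.Base using (true; false; T)
open import Data.Unit.Base using (tt)
open import Data.Empty using (⊥; ⊥-elim)
open import Data.Sum.Base using (_⊎_; inj₁; inj₂)
open import Data.Fin.Base using (Fin; toℕ; fromℕ<; remQuot; combine)
open import Data.Fin.Properties using (toℕ<n; ¬Fin0; remQuot-combine; combine-remQuot; toℕ-combine)
open import Data.Product.Base using (_×_; _,_; proj₁; proj₂; uncurry)
open import Data.Product.Function.NonDependent.Propositional using (_×-⤖_)
open import Function.Bundles using (_⤖_; _⇔_; mk⇔; mk↔ₛ′; Bijection)
open import Function.Construct.Composition using (_⤖-∘_; _⇔-∘_)
open import Function.Construct.Identity using (⤖-id)
open import Function.Properties.Inverse using (↔⇒⤖)
open import Relation.Nullary.Decidable.Core using (yes; no)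
open import Relation.Binary.PropositionalEquality
  using (_≡_; refl; sym; trans; cong; cong₂; subst; module ≡-Reasoning)

open ≡-Reasoning

diffMod-≤ : ∀ N {r s} → r ≤ s → diffMod N r s ≡ s ∸ r
diffMod-≤ N {r} {s} r≤s with r ≤ᵇ s in eq
... | true  = refl
... | false = ⊥-elim (subst T eq (≤⇒≤ᵇ r≤s))

diffMod-> : ∀ N {r s} → s < r → diffMod N r s ≡ N + s ∸ r
diffMod-> N {r} {s} s<r with r ≤ᵇ s in eq
... | false = refl
... | true  = ⊥-elim (<⇒≱ s<r (≤ᵇ⇒≤ r s (subst T (sym eq) tt)))

diffMod<N : ∀ {N r s} → r < N → s < N → diffMod N r s < N
diffMod<N {N} {r} {s} r<N s<N with r ≤? s
... | yes r≤s = subst (_< N) (sym (diffMod-≤ N r≤s)) (≤-<-trans (m∸n≤m s r) s<N)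
... | no  r≰s = subst (_< N) (sym (diffMod-> N (≰⇒> r≰s)))
                  (+-cancelʳ-< r _ _ (subst (_< N + r) (sym N+s∸r+r≡N+s) (+-monoʳ-< N (≰⇒> r≰s))))
  where
  N+s∸r+r≡N+s : N + s ∸ r + r ≡ N + s
  N+s∸r+r≡N+s = m∸n+n≡m (≤-trans (<⇒≤ r<N) (m≤m+n N s))

negMod≡diffMod : ∀ N k → negMod N k ≡ diffMod N k 0
negMod≡diffMod N zero    = refl
negMod≡diffMod N (suc k) = cong (_∸ suc k) (sym (+-identityʳ N))

diffMod+r≡s⊎N+s : ∀ N {r s} → r ≤ N → (diffMod N r s + r ≡ s) ⊎ (diffMod N r s + r ≡ N + s)
diffMod+r≡s⊎N+s N {r} {s} r≤N with r ≤? s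
... | yes r≤s = inj₁ (trans (cong (_+ r) (diffMod-≤ N r≤s)) (m∸n+n≡m r≤s))
... | no  r≰s = inj₂ (trans (cong (_+ r) (diffMod-> N (≰⇒> r≰s))) (m∸n+n≡m (≤-trans r≤N (m≤m+n N s))))

[diffMod+r]%M≡s%M : ∀ {M N} .{{_ : NonZero M}} → M ∣ N → ∀ {r} s → r ≤ N →
                    (diffMod N r s + r) % M ≡ s % M
[diffMod+r]%M≡s%M {M} {N} M∣N s r≤N with diffMod+r≡s⊎N+s N {s = s} r≤N
... | inj₁ eq = cong (_% M) eq
... | inj₂ eq = trans (cong (_% M) eq) (%-remove-+ˡ s M∣N)

[m%d+n]%d≡[m+n]%d : ∀ m n d .{{_ : NonZero d}} → (m % d + n) % d ≡ (m + n) % d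
[m%d+n]%d≡[m+n]%d m n d = begin
  (m % d + n) % d         ≡⟨ %-distribˡ-+ (m % d) n d ⟩
  (m % d % d + n % d) % d ≡⟨ cong (λ t → (t + n % d) % d) (m%n%n≡m%n m d) ⟩
  (m % d + n % d) % d     ≡⟨ %-distribˡ-+ m n d ⟨
  (m + n) % d             ∎

-- Adding d ∸ r undoes adding r modulo d.
+-%-cancelʳ : ∀ {d} .{{_ : NonZero d}} {e f r} → e < d → f < d → r < d →
              (e + r) % d ≡ (f + r) % d → e ≡ f
+-%-cancelʳ {d} {e} {f} {r} e<d f<d r<d eq = begin
  e                                ≡⟨ recover e<d ⟨
  ((e + r) % d + (d ∸ r)) % d      ≡⟨ cong (λ t → (t + (d ∸ r)) % d) eq ⟩
  ((f + r) % d + (d ∸ r)) % d      ≡⟨ recover f<d ⟩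
  f                                ∎
  where
  recover : ∀ {x} → x < d → ((x + r) % d + (d ∸ r)) % d ≡ x
  recover {x} x<d = begin
    ((x + r) % d + (d ∸ r)) % d ≡⟨ [m%d+n]%d≡[m+n]%d (x + r) (d ∸ r) d ⟩
    (x + r + (d ∸ r)) % d       ≡⟨ cong (_% d) (+-assoc x r (d ∸ r)) ⟩
    (x + (r + (d ∸ r))) % d     ≡⟨ cong (λ t → (x + t) % d) (m+[n∸m]≡n (<⇒≤ r<d)) ⟩
    (x + d) % d                 ≡⟨ [m+n]%n≡m%n x d ⟩
    x % d                       ≡⟨ m<n⇒m%n≡m x<d ⟩
    x                           ∎

diffMod-% : ∀ {M N} .{{_ : NonZero M}} → M ∣ N → ∀ {x} y → x ≤ N →
            diffMod N x y % M ≡ diffMod M (x % M) (y % M)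
diffMod-% {M} {N} M∣N {x} y x≤N =
  +-%-cancelʳ (m%n<n _ M) (diffMod<N (m%n<n x M) (m%n<n y M)) (m%n<n x M) (begin
    (diffMod N x y % M + x % M) % M        ≡⟨ %-distribˡ-+ (diffMod N x y) x M ⟨
    (diffMod N x y + x) % M                ≡⟨ [diffMod+r]%M≡s%M M∣N y x≤N ⟩
    y % M                                  ≡⟨ m%n%n≡m%n y M ⟨
    y % M % M                              ≡⟨ [diffMod+r]%M≡s%M ∣-refl (y % M) (m%n≤n x M) ⟨
    (diffMod M (x % M) (y % M) + x % M) % M ∎)

negMod-% : ∀ {M N} .{{_ : NonZero M}} → M ∣ N → ∀ {k} → k ≤ N →
           negMod N k % M ≡ negMod M (k % M)
negMod-% {M} {N} M∣N {k} k≤N = begin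
  negMod N k % M               ≡⟨ cong (_% M) (negMod≡diffMod N k) ⟩
  diffMod N k 0 % M            ≡⟨ diffMod-% M∣N 0 k≤N ⟩
  diffMod M (k % M) (0 % M)    ≡⟨ cong (diffMod M (k % M)) (n≤0⇒n≡0 (m%n≤m 0 M)) ⟩
  diffMod M (k % M) 0          ≡⟨ negMod≡diffMod M (k % M) ⟨
  negMod M (k % M)             ∎

remQuot-⤖ : ∀ n m → Fin (n * m) ⤖ (Fin n × Fin m)
remQuot-⤖ n m = ↔⇒⤖ (mk↔ₛ′ (remQuot {n} m) (uncurry combine)
                           (uncurry remQuot-combine) (combine-remQuot {n} m))

toℕ-remQuot : ∀ n m .{{_ : NonZero m}} (i : Fin (n * m)) →
              toℕ (proj₂ (remQuot {n} m i)) ≡ toℕ i % m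
toℕ-remQuot n m i = sym (begin
  toℕ i % m                 ≡⟨ cong (λ j → toℕ j % m) (combine-remQuot {n} m i) ⟨
  toℕ (combine q r) % m     ≡⟨ cong (_% m) (trans (toℕ-combine q r) (+-comm (m * toℕ q) (toℕ r))) ⟩
  (toℕ r + m * toℕ q) % m   ≡⟨ %-remove-+ʳ (toℕ r) (m∣m*n (toℕ q)) ⟩
  toℕ r % m                 ≡⟨ m<n⇒m%n≡m (toℕ<n r) ⟩
  toℕ r                     ∎)
  where
  q : Fin n
  r : Fin m
  q = proj₁ (remQuot {n} m i)
  r = proj₂ (remQuot {n} m i)

⊗-labelling : ∀ n {m} G → Fin m ⤖ V G → Fin (n * m) ⤖ V (Kstar n ⊗ G)
⊗-labelling n {m} G σ = (⤖-id (Fin n) ×-⤖ σ) ⤖-∘ remQuot-⤖ n m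

circulant-of-empty : ∀ {N} H → Fin N ⤖ V H → (Fin N → ⊥) → Circulant N H
circulant-of-empty H σ ¬i =
  σ , (λ _ → ⊥) , (λ k k<N → ⊥-elim (¬i (fromℕ< k<N))) , (λ i → ⊥-elim (¬i i))

⊗-circulant : ∀ m .{{_ : NonZero m}} G → Circulant m G → ∀ n → Circulant (n * m) (Kstar n ⊗ G)
⊗-circulant m G (σ , S , S-sym , S-adj) n = ⊗-labelling n G σ , S′ , S′-sym , S′-adj
  where
  S′ : ℕ → Set
  S′ d = S (d % m)

  S′-sym : ∀ k → k < n * m → S′ k ⇔ S′ (negMod (n * m) k)
  S′-sym k k<nm = subst (λ d → S′ k ⇔ S d) (sym (negMod-% (n∣m*n n) (<⇒≤ k<nm)))
                       (S-sym (k % m) (m%n<n k m))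

  label : Fin (n * m) → Fin n × V G
  label = Bijection.to (⊗-labelling n G σ)

  S′-adj : ∀ i j → Adj (Kstar n ⊗ G) (label i) (label j) ⇔ S′ (diffMod (n * m) (toℕ i) (toℕ j))
  S′-adj i j = remainders-adjacent ⇔-∘ mk⇔ proj₂ (tt ,_)
    where
    rᵢ rⱼ : Fin m
    rᵢ = proj₂ (remQuot {n} m i)
    rⱼ = proj₂ (remQuot {n} m j)

    remainders-differ : diffMod m (toℕ rᵢ) (toℕ rⱼ) ≡ diffMod (n * m) (toℕ i) (toℕ j) % m
    remainders-differ = begin
      diffMod m (toℕ rᵢ) (toℕ rⱼ)             ≡⟨ cong₂ (diffMod m) (toℕ-remQuot n m i) (toℕ-remQuot n m j) ⟩
      diffMod m (toℕ i % m) (toℕ j % m)       ≡⟨ diffMod-% (n∣m*n n) (toℕ j) (<⇒≤ (toℕ<n i)) ⟨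
      diffMod (n * m) (toℕ i) (toℕ j) % m     ∎

    remainders-adjacent : Adj G (label i .proj₂) (label j .proj₂) ⇔ S′ (diffMod (n * m) (toℕ i) (toℕ j))
    remainders-adjacent = subst (λ d → Adj G (label i .proj₂) (label j .proj₂) ⇔ S d)
                                remainders-differ (S-adj rᵢ rⱼ)

lemma6 : (m : ℕ) (G : Graph) → Circulant m G →
    (n : ℕ) → n ≥ 1 → Circulant (n * m) (Kstar n ⊗ G)
lemma6 zero       G (σ , _) n _ =
  circulant-of-empty (Kstar n ⊗ G) (⊗-labelling n G σ) (λ i → ¬Fin0 (subst Fin (*-zeroʳ n) i))
lemma6 m@(suc _)  G circ    n _ = ⊗-circulant m G circ n
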